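{- Let $S=(S_{ij})_{i,j\ge 0}$ be the infinite lower-triangular matrix with $S_{ij}=\binom{i}{j} \bmod 2\in\{0,1\}$ (Pascal's triangle mod 2, left-justified; $S_{ij}=0$ for $j>i$). Then $S$ is invertible (as an infinite lower-triangular matrix), and $S^{ -1}$ is a $(-1,0,1)$-matrix which has its zero entries in exactly the same positions as $S$. Moreover, for every column $j\ge 0$, the sequence of nonzero entries of column $j$ of $S^{ -1}$, read from top to bottom (starting at the diagonal entry), is the Prouhet-Thue-Morse word $t(1,-1)$, i.e. the sequence $\big((-1)^{b(n)}\big)_{n\ge 0}=1,-1,-1,1,-1,1,1,-1,\dots$, where $b(n)$ denotes the sum of the binary digits of $n$.
   Context: Infinite lower-triangular matrices are multiplied in the usual way (each entry of a product is a finite sum). The Prouhet-Thue-Morse word $t(a,b)$ on a two-letter alphabet $\{a,b\}$ is obtained by starting with $a$ and repeatedly appending to the current word its image under switching the letters $a\leftrightarrow b$ ($a$, $ab$, $abba$, $abbabaab$, \dots); $t(1,-1)$ is this word with $a=1$, $b=-1$, which equals $\big((-1)^{b(n)}\big)_{n\ge0}$. -}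

module Defs where

open import Data.Nat as ℕ using (ℕ; zero; suc; _%_; _/_)
open import Data.Nat.Combinatorics using (_C_)
open import Data.Integer as ℤ using (ℤ; +_; -_)
open import Data.Bool using (if_then_else_)
open import Relation.Nullary using (¬_; does)
open import Relation.Binary.PropositionalEquality using (_≡_)
open import Data.Integer.Properties using () renaming (_≟_ to _≟ℤ_)

Matrix : Set
Matrix = ℕ → ℕ → ℤ

LowerTriangular : Matrix → Set
LowerTriangular A = ∀ i j → i ℕ.< j → A i j ≡ + 0

sumTo : ℕ → (ℕ → ℤ) → ℤ
sumTo zero    f = + 0
sumTo (suc n) f = sumTo n f ℤ.+ f n

-- Product of lower-triangular matrices: (A·B) i j = Σ_{k=0}^{i} A i k * B k j
-- (the terms with k > i vanish since A is lower triangular).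
_·_ : Matrix → Matrix → Matrix
(A · B) i j = sumTo (suc i) (λ k → A i k ℤ.* B k j)

I : Matrix
I i j = if does (i ℕ.≟ j) then + 1 else + 0

S : Matrix
S i j = + ((i C j) % 2)

nonzerosAbove : Matrix → ℕ → ℕ → ℕ
nonzerosAbove A j zero    = 0
nonzerosAbove A j (suc i) =
  if does (A i j ≟ℤ + 0) then nonzerosAbove A j i else suc (nonzerosAbove A j i)

-- b(n): sum of binary digits of n (fuel-based; fuel n suffices)
binSumFuel : ℕ → ℕ → ℕ
binSumFuel zero    n = 0
binSumFuel (suc f) n = (n % 2) ℕ.+ binSumFuel f (n / 2)

b : ℕ → ℕ
b n = binSumFuel n n

neg1^ : ℕ → ℤ
neg1^ zero    = + 1
neg1^ (suc m) = - neg1^ m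

tm : ℕ → ℤ
tm n = neg1^ (b n)

-- By Lucas' theorem, S (2a + r) (2c + s) = S a c · S r s for binary digits r, s: S is the
-- infinite Kronecker power of its corner σ = [[1,0],[1,1]]. A product of two such self-similar
-- matrices is again self-similar, with the product of the corners as corner, and a
-- self-similar matrix is determined by its corner. Hence the Kronecker power T of
-- σ⁻¹ = [[1,0],[-1,1]] = δ σ δ, δ = diag(1,-1), is a two-sided inverse of S, and
-- T i j = S i j · t(i) · t(j) with t(n) = (-1)^{b(n)}. It remains to see that t(i) t(j) is
-- t applied to the number of odd entries above row i in column j whenever S i j = 1, which
-- again follows one binary digit at a time.

module Submission where

open import Data.Bool.Base using (Bool; true; false; not; _∧_; _xor_; if_then_else_)
open import Data.Bool.Properties using (¬-not; not-involutive; ∧-identityʳ; ∧-zeroʳ; xor-identityʳ)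
open import Data.Integer.Base as ℤ using (ℤ; +_; -_)
import Data.Integer.Properties as ℤₚ
open import Algebra.Properties.CommutativeSemigroup ℤₚ.*-commutativeSemigroup
  using () renaming (interchange to *-interchange)
open import Data.Integer.Tactic.RingSolver using (solve-∀)
open import Data.Nat.Base as ℕ using (ℕ; zero; suc; _≤_; _<_; z≤n; s≤s; _%_; _/_)
import Data.Nat.Properties as ℕₚ
open import Data.Nat.Combinatorics using (_C_; k>n⇒nCk≡0; nCk+nC[k+1]≡[n+1]C[k+1])
open import Data.Nat.DivMod using (%-distribˡ-+; m/n≡1+[m∸n]/n; m/n<m)
open import Data.Nat.Induction using (<-rec)
open import Data.Product using (Σ; ∃; _×_; _,_)
open import Data.Sum using (_⊎_; inj₁; inj₂)
open import Function.Base using (_∘_)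
open import Function.Bundles using (_⇔_; mk⇔)
open import Function.Properties.Equivalence using () renaming (sym to ⇔-sym; trans to ⇔-trans)
open import Relation.Nullary using (¬_; yes; no)
open import Relation.Binary.PropositionalEquality
  using (_≡_; _≢_; refl; sym; trans; cong; cong₂; module ≡-Reasoning)

open import Defs

open ≡-Reasoning

double : ℕ → ℕ
double zero    = zero
double (suc n) = suc (suc (double n))

bit : Bool → ℕ → ℕ
bit false n = double n
bit true  n = suc (double n)

toℕ : Bool → ℕ
toℕ false = 0
toℕ true  = 1

bit-suc : ∀ r n → bit r (suc n) ≡ suc (suc (bit r n))
bit-suc false n = refl
bit-suc true  n = refl

n≤double[n] : ∀ n → n ≤ double n
n≤double[n] zero    = z≤n
n≤double[n] (suc n) = s≤s (ℕₚ.m≤n⇒m≤1+n (n≤double[n] n))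

data BitView : ℕ → Set where
  bits : ∀ r n → BitView (bit r n)

bitView : ∀ n → BitView n
bitView zero = bits false 0
bitView (suc n) with bitView n
... | bits false m = bits true m
... | bits true  m = bits false (suc m)

binary-rec : (P : ℕ → Set) → P 0 → (∀ r n → P n → P (bit r n)) → ∀ n → P n
binary-rec P base step = <-rec P go
  where
  go : ∀ n → (∀ {m} → m < n → P m) → P n
  go n rec with bitView n
  ... | bits false zero    = base
  ... | bits false (suc m) = step false (suc m) (rec (s≤s (s≤s (n≤double[n] m))))
  ... | bits true  m       = step true m (rec (s≤s (n≤double[n] m)))

bit%2 : ∀ r n → bit r n % 2 ≡ toℕ r
bit%2 false zero    = refl
bit%2 true  zero    = refl
bit%2 false (suc n) = bit%2 false n
bit%2 true  (suc n) = bit%2 true n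

bit/2 : ∀ r n → bit r n / 2 ≡ n
bit/2 false zero    = refl
bit/2 true  zero    = refl
bit/2 r     (suc n) = begin
  bit r (suc n) / 2         ≡⟨ cong (_/ 2) (bit-suc r n) ⟩
  suc (suc (bit r n)) / 2   ≡⟨ m/n≡1+[m∸n]/n {suc (suc (bit r n))} {2} (s≤s (s≤s z≤n)) ⟩
  suc (bit r n / 2)         ≡⟨ cong suc (bit/2 r n) ⟩
  suc n                     ∎

binSumFuel-zero : ∀ f → binSumFuel f 0 ≡ 0
binSumFuel-zero zero    = refl
binSumFuel-zero (suc f) = binSumFuel-zero f

n≤1+f⇒n/2≤f : ∀ n f → n ≤ suc f → n / 2 ≤ f
n≤1+f⇒n/2≤f zero    f _           = z≤n
n≤1+f⇒n/2≤f (suc n) f (s≤s n≤f) = ℕₚ.≤-trans (ℕₚ.≤-pred (m/n<m (suc n) 2 (s≤s (s≤s z≤n)))) n≤f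

binSumFuel-fuel : ∀ f g n → n ≤ f → n ≤ g → binSumFuel f n ≡ binSumFuel g n
binSumFuel-fuel zero    g       .zero z≤n _   = sym (binSumFuel-zero g)
binSumFuel-fuel (suc f) zero    .zero _   z≤n = binSumFuel-zero (suc f)
binSumFuel-fuel (suc f) (suc g) n     n≤f n≤g =
  cong (n % 2 ℕ.+_) (binSumFuel-fuel f g (n / 2) (n≤1+f⇒n/2≤f n f n≤f) (n≤1+f⇒n/2≤f n g n≤g))

b-suc : ∀ m n → n ≤ m → suc m / 2 ≡ n → b (suc m) ≡ suc m % 2 ℕ.+ b n
b-suc m n n≤m half = cong (suc m % 2 ℕ.+_)
  (trans (cong (binSumFuel m) half) (binSumFuel-fuel m n n n≤m ℕₚ.≤-refl))

b-bit : ∀ r n → b (bit r n) ≡ toℕ r ℕ.+ b n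
b-bit false zero    = refl
b-bit false (suc n) =
  trans (b-suc (suc (double n)) (suc n) (s≤s (n≤double[n] n)) (bit/2 false (suc n)))
        (cong (ℕ._+ b (suc n)) (bit%2 false (suc n)))
b-bit true  n       =
  trans (b-suc (double n) n (n≤double[n] n) (bit/2 true n)) (cong (ℕ._+ b n) (bit%2 true n))

tm-double : ∀ n → tm (double n) ≡ tm n
tm-double n = cong neg1^ (b-bit false n)

tm-suc-double : ∀ n → tm (suc (double n)) ≡ - tm n
tm-suc-double n = cong neg1^ (b-bit true n)

tm-bit : ∀ r n → tm (bit r n) ≡ tm n ℤ.* tm (bit r 0)
tm-bit false n = trans (tm-double n) (sym (ℤₚ.*-identityʳ (tm n)))
tm-bit true  n = trans (tm-suc-double n) (neg≡*-1 (tm n))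
  where
  neg≡*-1 : ∀ x → - x ≡ x ℤ.* - + 1
  neg≡*-1 = solve-∀

neg1^-±1 : ∀ m → neg1^ m ≡ + 1 ⊎ neg1^ m ≡ - + 1
neg1^-±1 zero = inj₁ refl
neg1^-±1 (suc m) with neg1^-±1 m
... | inj₁ e = inj₂ (cong -_ e)
... | inj₂ e = inj₁ (cong -_ e)

neg1^≢0 : ∀ m → neg1^ m ≢ + 0
neg1^≢0 zero    ()
neg1^≢0 (suc m) e = neg1^≢0 m (ℤₚ.neg-injective e)

_C₂_ : ℕ → ℕ → Bool
zero  C₂ zero  = true
zero  C₂ suc k = false
suc n C₂ zero  = true
suc n C₂ suc k = (n C₂ k) xor (n C₂ suc k)

nC₂0≡true : ∀ n → n C₂ 0 ≡ true
nC₂0≡true zero    = refl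
nC₂0≡true (suc n) = refl

C₂-upper : ∀ {n k} → n < k → n C₂ k ≡ false
C₂-upper {zero}  {suc k} _           = refl
C₂-upper {suc n} {suc k} (s≤s n<k) = cong₂ _xor_ (C₂-upper n<k) (C₂-upper (ℕₚ.m≤n⇒m≤1+n n<k))

nCk%2≡C₂ : ∀ n k → (n C k) % 2 ≡ toℕ (n C₂ k)
nCk%2≡C₂ zero    zero    = refl
nCk%2≡C₂ zero    (suc k) = cong (_% 2) (k>n⇒nCk≡0 {0} {suc k} (s≤s z≤n))
nCk%2≡C₂ (suc n) zero    = refl
nCk%2≡C₂ (suc n) (suc k) = begin
  (suc n C suc k) % 2                        ≡⟨ cong (_% 2) (nCk+nC[k+1]≡[n+1]C[k+1] n k) ⟨
  (n C k ℕ.+ n C suc k) % 2                  ≡⟨ %-distribˡ-+ (n C k) (n C suc k) 2 ⟩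
  ((n C k) % 2 ℕ.+ (n C suc k) % 2) % 2      ≡⟨ cong₂ (λ x y → (x ℕ.+ y) % 2) (nCk%2≡C₂ n k) (nCk%2≡C₂ n (suc k)) ⟩
  (toℕ (n C₂ k) ℕ.+ toℕ (n C₂ suc k)) % 2    ≡⟨ toℕ-xor (n C₂ k) (n C₂ suc k) ⟩
  toℕ (suc n C₂ suc k)                       ∎
  where
  toℕ-xor : ∀ x y → (toℕ x ℕ.+ toℕ y) % 2 ≡ toℕ (x xor y)
  toℕ-xor false false = refl
  toℕ-xor false true  = refl
  toℕ-xor true  false = refl
  toℕ-xor true  true  = refl

xor-cancel-middle : ∀ x y z → (x xor y) xor (y xor z) ≡ x xor z
xor-cancel-middle false false z = refl
xor-cancel-middle false true  z = not-involutive z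
xor-cancel-middle true  false z = refl
xor-cancel-middle true  true  z = refl

C₂-suc-suc : ∀ n k → suc (suc n) C₂ suc (suc k) ≡ (n C₂ k) xor (n C₂ suc (suc k))
C₂-suc-suc n k = xor-cancel-middle (n C₂ k) (n C₂ suc k) (n C₂ suc (suc k))

C₂-suc-suc-1 : ∀ n → suc (suc n) C₂ 1 ≡ n C₂ 1
C₂-suc-suc-1 n = trans (cong (λ x → not (x xor (n C₂ 1))) (nC₂0≡true n)) (not-involutive (n C₂ 1))

C₂-double-double : ∀ a c → double a C₂ double c ≡ a C₂ c
C₂-double-double zero    zero    = refl
C₂-double-double zero    (suc c) = refl
C₂-double-double (suc a) zero    = refl
C₂-double-double (suc a) (suc c) = trans (C₂-suc-suc (double a) (double c))
  (cong₂ _xor_ (C₂-double-double a c) (C₂-double-double a (suc c)))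

C₂-double-odd : ∀ a c → double a C₂ suc (double c) ≡ false
C₂-double-odd zero    c       = refl
C₂-double-odd (suc a) zero    = trans (C₂-suc-suc-1 (double a)) (C₂-double-odd a zero)
C₂-double-odd (suc a) (suc c) = trans (C₂-suc-suc (double a) (suc (double c)))
  (cong₂ _xor_ (C₂-double-odd a c) (C₂-double-odd a (suc c)))

C₂-odd-double : ∀ a c → suc (double a) C₂ double c ≡ a C₂ c
C₂-odd-double a zero    = sym (nC₂0≡true a)
C₂-odd-double a (suc c) = cong₂ _xor_ (C₂-double-odd a c) (C₂-double-double a (suc c))

C₂-odd-odd : ∀ a c → suc (double a) C₂ suc (double c) ≡ a C₂ c
C₂-odd-odd a c = trans (cong₂ _xor_ (C₂-double-double a c) (C₂-double-odd a c)) (xor-identityʳ (a C₂ c))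

C₂-bit : ∀ r s a c → bit r a C₂ bit s c ≡ (a C₂ c) ∧ (bit r 0 C₂ bit s 0)
C₂-bit false false a c = trans (C₂-double-double a c) (sym (∧-identityʳ (a C₂ c)))
C₂-bit false true  a c = trans (C₂-double-odd a c) (sym (∧-zeroʳ (a C₂ c)))
C₂-bit true  false a c = trans (C₂-odd-double a c) (sym (∧-identityʳ (a C₂ c)))
C₂-bit true  true  a c = trans (C₂-odd-odd a c) (sym (∧-identityʳ (a C₂ c)))

sumTo-cong : ∀ n {f g : ℕ → ℤ} → (∀ k → f k ≡ g k) → sumTo n f ≡ sumTo n g
sumTo-cong zero    f≗g = refl
sumTo-cong (suc n) f≗g = cong₂ ℤ._+_ (sumTo-cong n f≗g) (f≗g n)

sumTo-*ʳ : ∀ n (f : ℕ → ℤ) x → sumTo n (λ k → f k ℤ.* x) ≡ sumTo n f ℤ.* x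
sumTo-*ʳ zero    f x = sym (ℤₚ.*-zeroˡ x)
sumTo-*ʳ (suc n) f x = trans (cong (ℤ._+ f n ℤ.* x) (sumTo-*ʳ n f x))
  (sym (ℤₚ.*-distribʳ-+ x (sumTo n f) (f n)))

sumTo-double : ∀ n (f : ℕ → ℤ) → sumTo (double n) f ≡ sumTo n (λ k → f (double k) ℤ.+ f (suc (double k)))
sumTo-double zero    f = refl
sumTo-double (suc n) f = trans (ℤₚ.+-assoc (sumTo (double n) f) (f (double n)) (f (suc (double n))))
  (cong (ℤ._+ (f (double n) ℤ.+ f (suc (double n)))) (sumTo-double n f))

·-extend : ∀ A B i j → A i (suc i) ≡ + 0 → (A · B) i j ≡ sumTo (suc (suc i)) (λ k → A i k ℤ.* B k j)
·-extend A B i j Ai[1+i]≡0 =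
  sym (trans (cong (λ x → (A · B) i j ℤ.+ x ℤ.* B (suc i) j) Ai[1+i]≡0) (ℤₚ.+-identityʳ _))


SelfSimilar : Matrix → Set
SelfSimilar A = ∀ r s a c → A (bit r a) (bit s c) ≡ A a c ℤ.* A (bit r 0) (bit s 0)

selfSimilar-resp : ∀ A B → (∀ i j → A i j ≡ B i j) → SelfSimilar A → SelfSimilar B
selfSimilar-resp A B A≗B ssA r s a c = begin
  B (bit r a) (bit s c)                 ≡⟨ A≗B (bit r a) (bit s c) ⟨
  A (bit r a) (bit s c)                 ≡⟨ ssA r s a c ⟩
  A a c ℤ.* A (bit r 0) (bit s 0)       ≡⟨ cong₂ ℤ._*_ (A≗B a c) (A≗B (bit r 0) (bit s 0)) ⟩
  B a c ℤ.* B (bit r 0) (bit s 0)       ∎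

selfSimilar-* : ∀ A B → SelfSimilar A → SelfSimilar B → SelfSimilar (λ i j → A i j ℤ.* B i j)
selfSimilar-* A B ssA ssB r s a c =
  trans (cong₂ ℤ._*_ (ssA r s a c) (ssB r s a c))
        (*-interchange (A a c) (A (bit r 0) (bit s 0)) (B a c) (B (bit r 0) (bit s 0)))

selfSimilar-outer : ∀ (f : ℕ → ℤ) → (∀ r n → f (bit r n) ≡ f n ℤ.* f (bit r 0)) → SelfSimilar (λ i j → f i ℤ.* f j)
selfSimilar-outer f f-bit r s a c =
  trans (cong₂ ℤ._*_ (f-bit r a) (f-bit s c))
        (*-interchange (f a) (f (bit r 0)) (f c) (f (bit s 0)))

-- Row 2a of A · B sums only up to k = 2a; A 0 1 ≡ 0 supplies the missing term k = 2a + 1.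
·-rowPairs : ∀ A B → SelfSimilar A → A 0 1 ≡ + 0 → ∀ r a j →
  (A · B) (bit r a) j ≡ sumTo (double (suc a)) (λ k → A (bit r a) k ℤ.* B k j)
·-rowPairs A B ssA A01≡0 false a j = ·-extend A B (double a) j (begin
  A (double a) (suc (double a))   ≡⟨ ssA false true a a ⟩
  A a a ℤ.* A 0 1                 ≡⟨ cong (A a a ℤ.*_) A01≡0 ⟩
  A a a ℤ.* + 0                   ≡⟨ ℤₚ.*-zeroʳ (A a a) ⟩
  + 0                             ∎)
·-rowPairs A B ssA A01≡0 true a j = refl

·-selfSimilar : ∀ A B → SelfSimilar A → SelfSimilar B → A 0 1 ≡ + 0 → SelfSimilar (A · B)
·-selfSimilar A B ssA ssB A01≡0 r s a c = begin
  (A · B) (bit r a) (bit s c)                                ≡⟨ ·-rowPairs A B ssA A01≡0 r a (bit s c) ⟩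
  sumTo (double (suc a)) F                                   ≡⟨ sumTo-double (suc a) F ⟩
  sumTo (suc a) (λ k → F (double k) ℤ.+ F (suc (double k)))  ≡⟨ sumTo-cong (suc a) pair ⟩
  sumTo (suc a) (λ k → (A a k ℤ.* B k c) ℤ.* corner)         ≡⟨ sumTo-*ʳ (suc a) (λ k → A a k ℤ.* B k c) corner ⟩
  (A · B) a c ℤ.* corner                                     ≡⟨ cong ((A · B) a c ℤ.*_) (·-rowPairs A B ssA A01≡0 r 0 (bit s 0)) ⟨
  (A · B) a c ℤ.* (A · B) (bit r 0) (bit s 0)                ∎
  where
  F : ℕ → ℤ
  F k = A (bit r a) k ℤ.* B k (bit s c)
  corner : ℤ
  corner = sumTo 2 (λ k → A (bit r 0) k ℤ.* B k (bit s 0))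
  distrib : ∀ x y p q u v →
    (x ℤ.* p) ℤ.* (y ℤ.* q) ℤ.+ (x ℤ.* u) ℤ.* (y ℤ.* v) ≡ (x ℤ.* y) ℤ.* ((+ 0 ℤ.+ p ℤ.* q) ℤ.+ u ℤ.* v)
  distrib = solve-∀
  pair : ∀ k → F (double k) ℤ.+ F (suc (double k)) ≡ (A a k ℤ.* B k c) ℤ.* corner
  pair k = trans
    (cong₂ ℤ._+_ (cong₂ ℤ._*_ (ssA r false a k) (ssB false s k c))
                 (cong₂ ℤ._*_ (ssA r true a k) (ssB true s k c)))
    (distrib (A a k) (B k c) (A (bit r 0) 0) (B 0 (bit s 0)) (A (bit r 0) 1) (B 1 (bit s 0)))

I-selfSimilar : SelfSimilar I
I-selfSimilar r     s     zero    zero    = sym (ℤₚ.*-identityˡ (I (bit r 0) (bit s 0)))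
I-selfSimilar false s     zero    (suc c) rewrite bit-suc s c = refl
I-selfSimilar true  s     zero    (suc c) rewrite bit-suc s c = refl
I-selfSimilar r     false (suc a) zero    rewrite bit-suc r a = refl
I-selfSimilar r     true  (suc a) zero    rewrite bit-suc r a = refl
I-selfSimilar r     s     (suc a) (suc c) rewrite bit-suc r a | bit-suc s c = I-selfSimilar r s a c

selfSimilar-unique : ∀ A B → SelfSimilar A → SelfSimilar B →
  (∀ r s → A (bit r 0) (bit s 0) ≡ B (bit r 0) (bit s 0)) → ∀ i j → A i j ≡ B i j
selfSimilar-unique A B ssA ssB corner = binary-rec (λ i → ∀ j → A i j ≡ B i j) row₀ row
  where
  digit : ∀ r s a c → A a c ≡ B a c → A (bit r a) (bit s c) ≡ B (bit r a) (bit s c)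
  digit r s a c eq = trans (ssA r s a c) (trans (cong₂ ℤ._*_ eq (corner r s)) (sym (ssB r s a c)))
  row₀ : ∀ j → A 0 j ≡ B 0 j
  row₀ = binary-rec (λ j → A 0 j ≡ B 0 j) (corner false false) (λ s c → digit false s 0 c)
  row : ∀ r a → (∀ j → A a j ≡ B a j) → ∀ j → A (bit r a) j ≡ B (bit r a) j
  row r a eq j with bitView j
  ... | bits s c = digit r s a c (eq c)

Pascal₂ : Matrix
Pascal₂ i j = + toℕ (i C₂ j)

S≡Pascal₂ : ∀ i j → S i j ≡ Pascal₂ i j
S≡Pascal₂ i j = cong +_ (nCk%2≡C₂ i j)

Pascal₂-selfSimilar : SelfSimilar Pascal₂
Pascal₂-selfSimilar r s a c = trans (cong (+_ ∘ toℕ) (C₂-bit r s a c)) (toℤ-∧ (a C₂ c) (bit r 0 C₂ bit s 0))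
  where
  toℤ-∧ : ∀ x y → + toℕ (x ∧ y) ≡ + toℕ x ℤ.* + toℕ y
  toℤ-∧ false y = refl
  toℤ-∧ true  y = sym (ℤₚ.*-identityˡ (+ toℕ y))

S-selfSimilar : SelfSimilar S
S-selfSimilar = selfSimilar-resp Pascal₂ S (λ i j → sym (S≡Pascal₂ i j)) Pascal₂-selfSimilar

T : Matrix
T i j = Pascal₂ i j ℤ.* (tm i ℤ.* tm j)

T-selfSimilar : SelfSimilar T
T-selfSimilar = selfSimilar-* Pascal₂ (λ i j → tm i ℤ.* tm j) Pascal₂-selfSimilar (selfSimilar-outer tm tm-bit)

S·T≡I : ∀ i j → (S · T) i j ≡ I i j
S·T≡I = selfSimilar-unique (S · T) I (·-selfSimilar S T S-selfSimilar T-selfSimilar refl) I-selfSimilar corner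
  where
  corner : ∀ r s → (S · T) (bit r 0) (bit s 0) ≡ I (bit r 0) (bit s 0)
  corner false false = refl
  corner false true  = refl
  corner true  false = refl
  corner true  true  = refl

T·S≡I : ∀ i j → (T · S) i j ≡ I i j
T·S≡I = selfSimilar-unique (T · S) I (·-selfSimilar T S T-selfSimilar S-selfSimilar refl) I-selfSimilar corner
  where
  corner : ∀ r s → (T · S) (bit r 0) (bit s 0) ≡ I (bit r 0) (bit s 0)
  corner false false = refl
  corner false true  = refl
  corner true  false = refl
  corner true  true  = refl

count : ℕ → ℕ → ℕ
count j zero    = 0
count j (suc i) = if i C₂ j then suc (count j i) else count j i

count-zero : ∀ n → count 0 n ≡ n
count-zero zero    = refl
count-zero (suc n) rewrite nC₂0≡true n = cong suc (count-zero n)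

count-double : ∀ c a → count (double c) (double a) ≡ double (count c a)
count-double c zero = refl
count-double c (suc a) rewrite C₂-odd-double a c | C₂-double-double a c | count-double c a with a C₂ c
... | true  = refl
... | false = refl

count-double-suc : ∀ c a → a C₂ c ≡ true → count (double c) (suc (double a)) ≡ suc (double (count c a))
count-double-suc c a e rewrite C₂-double-double a c | e = cong suc (count-double c a)

count-odd-double : ∀ c a → count (suc (double c)) (double a) ≡ count c a
count-odd-double c zero    = refl
count-odd-double c (suc a) rewrite C₂-odd-odd a c | C₂-double-odd a c =
  cong (λ n → if a C₂ c then suc n else n) (count-odd-double c a)

count-odd-odd : ∀ c a → count (suc (double c)) (suc (double a)) ≡ count c a
count-odd-odd c a rewrite C₂-double-odd a c = count-odd-double c a

tm*tm≡tm-count : ∀ i j → i C₂ j ≡ true → tm i ℤ.* tm j ≡ tm (count j i)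
tm*tm≡tm-count = binary-rec (λ i → ∀ j → i C₂ j ≡ true → tm i ℤ.* tm j ≡ tm (count j i)) base step
  where
  base : ∀ j → 0 C₂ j ≡ true → tm 0 ℤ.* tm j ≡ tm (count j 0)
  base zero _ = refl
  step : ∀ r a → (∀ c → a C₂ c ≡ true → tm a ℤ.* tm c ≡ tm (count c a)) →
         ∀ j → bit r a C₂ j ≡ true → tm (bit r a) ℤ.* tm j ≡ tm (count j (bit r a))
  step r a ih j e with bitView j
  step false a ih _ e | bits false c = begin
    tm (double a) ℤ.* tm (double c)    ≡⟨ cong₂ ℤ._*_ (tm-double a) (tm-double c) ⟩
    tm a ℤ.* tm c                      ≡⟨ ih c (trans (sym (C₂-double-double a c)) e) ⟩
    tm (count c a)                     ≡⟨ tm-double (count c a) ⟨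
    tm (double (count c a))            ≡⟨ cong tm (count-double c a) ⟨
    tm (count (double c) (double a))   ∎
  step false a ih _ e | bits true c with () ← trans (sym e) (C₂-double-odd a c)
  step true a ih _ e | bits false c = begin
    tm (suc (double a)) ℤ.* tm (double c)     ≡⟨ cong₂ ℤ._*_ (tm-suc-double a) (tm-double c) ⟩
    - tm a ℤ.* tm c                           ≡⟨ ℤₚ.neg-distribˡ-* (tm a) (tm c) ⟨
    - (tm a ℤ.* tm c)                         ≡⟨ cong -_ (ih c e′) ⟩
    - tm (count c a)                          ≡⟨ tm-suc-double (count c a) ⟨
    tm (suc (double (count c a)))             ≡⟨ cong tm (count-double-suc c a e′) ⟨
    tm (count (double c) (suc (double a)))    ∎
    where
    e′ : a C₂ c ≡ true
    e′ = trans (sym (C₂-odd-double a c)) e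
  step true a ih _ e | bits true c = begin
    tm (suc (double a)) ℤ.* tm (suc (double c))    ≡⟨ cong₂ ℤ._*_ (tm-suc-double a) (tm-suc-double c) ⟩
    - tm a ℤ.* - tm c                              ≡⟨ neg*neg (tm a) (tm c) ⟩
    tm a ℤ.* tm c                                  ≡⟨ ih c (trans (sym (C₂-odd-odd a c)) e) ⟩
    tm (count c a)                                 ≡⟨ cong tm (count-odd-odd c a) ⟨
    tm (count (suc (double c)) (suc (double a)))   ∎
    where
    neg*neg : ∀ x y → - x ℤ.* - y ≡ x ℤ.* y
    neg*neg = solve-∀

count-surjective : ∀ j n → ∃ λ i → i C₂ j ≡ true × count j i ≡ n
count-surjective = binary-rec (λ j → ∀ n → ∃ λ i → i C₂ j ≡ true × count j i ≡ n) base step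
  where
  base : ∀ n → ∃ λ i → i C₂ 0 ≡ true × count 0 i ≡ n
  base n = n , nC₂0≡true n , count-zero n
  step : ∀ s c → (∀ n → ∃ λ i → i C₂ c ≡ true × count c i ≡ n) →
         ∀ n → ∃ λ i → i C₂ bit s c ≡ true × count (bit s c) i ≡ n
  step false c ih n with bitView n
  ... | bits false m = let (a , e , k) = ih m in
    double a , trans (C₂-double-double a c) e , trans (count-double c a) (cong double k)
  ... | bits true  m = let (a , e , k) = ih m in
    suc (double a) , trans (C₂-odd-double a c) e , trans (count-double-suc c a e) (cong (suc ∘ double) k)
  step true c ih n = let (a , e , k) = ih n in
    suc (double a) , trans (C₂-odd-odd a c) e , trans (count-odd-odd c a) k

C₂≡false⇒T≡0 : ∀ i j → i C₂ j ≡ false → T i j ≡ + 0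
C₂≡false⇒T≡0 i j e = cong (λ x → + toℕ x ℤ.* (tm i ℤ.* tm j)) e

C₂≡true⇒T≡tm : ∀ i j → i C₂ j ≡ true → T i j ≡ tm (count j i)
C₂≡true⇒T≡tm i j e = begin
  T i j                  ≡⟨ cong (λ x → + toℕ x ℤ.* (tm i ℤ.* tm j)) e ⟩
  + 1 ℤ.* (tm i ℤ.* tm j) ≡⟨ ℤₚ.*-identityˡ (tm i ℤ.* tm j) ⟩
  tm i ℤ.* tm j          ≡⟨ tm*tm≡tm-count i j e ⟩
  tm (count j i)         ∎

C₂≡true⇒T≢0 : ∀ i j → i C₂ j ≡ true → T i j ≢ + 0
C₂≡true⇒T≢0 i j e = neg1^≢0 (b (count j i)) ∘ trans (sym (C₂≡true⇒T≡tm i j e))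

T≡0⇒C₂≡false : ∀ i j → T i j ≡ + 0 → i C₂ j ≡ false
T≡0⇒C₂≡false i j T≡0 = ¬-not (λ e → C₂≡true⇒T≢0 i j e T≡0)

T≢0⇒C₂≡true : ∀ i j → T i j ≢ + 0 → i C₂ j ≡ true
T≢0⇒C₂≡true i j T≢0 = ¬-not (T≢0 ∘ C₂≡false⇒T≡0 i j)

S≡0⇔C₂≡false : ∀ i j → S i j ≡ + 0 ⇔ i C₂ j ≡ false
S≡0⇔C₂≡false i j rewrite S≡Pascal₂ i j with i C₂ j
... | true  = mk⇔ (λ ()) (λ ())
... | false = mk⇔ (λ _ → refl) (λ _ → refl)

nonzerosAbove-T : ∀ j i → nonzerosAbove T j i ≡ count j i
nonzerosAbove-T j zero    = refl
nonzerosAbove-T j (suc i) with T i j ℤₚ.≟ + 0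
... | yes T≡0 = begin
  nonzerosAbove T j i    ≡⟨ nonzerosAbove-T j i ⟩
  count j i              ≡⟨ cong (λ t → if t then suc (count j i) else count j i) (T≡0⇒C₂≡false i j T≡0) ⟨
  count j (suc i)        ∎
... | no T≢0 = begin
  suc (nonzerosAbove T j i) ≡⟨ cong suc (nonzerosAbove-T j i) ⟩
  suc (count j i)           ≡⟨ cong (λ t → if t then suc (count j i) else count j i) (T≢0⇒C₂≡true i j T≢0) ⟨
  count j (suc i)           ∎

theorem1 : Σ Matrix λ T →
    (LowerTriangular T × (∀ i j → (S · T) i j ≡ I i j) × (∀ i j → (T · S) i j ≡ I i j))
    × (∀ i j → T i j ≡ - (+ 1) ⊎ T i j ≡ + 0 ⊎ T i j ≡ + 1)
    × (∀ i j → (T i j ≡ + 0 ⇔ S i j ≡ + 0))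
    × (∀ i j → ¬ T i j ≡ + 0 → T i j ≡ tm (nonzerosAbove T j i))
    × (∀ j n → ∃ λ i → ¬ T i j ≡ + 0 × nonzerosAbove T j i ≡ n)
theorem1 = T , (lower , S·T≡I , T·S≡I) , entries , zeros , signs , exhaustive
  where
  lower : LowerTriangular T
  lower i j i<j = C₂≡false⇒T≡0 i j (C₂-upper i<j)
  entries : ∀ i j → T i j ≡ - (+ 1) ⊎ T i j ≡ + 0 ⊎ T i j ≡ + 1
  entries i j with T i j ℤₚ.≟ + 0
  ... | yes T≡0  = inj₂ (inj₁ T≡0)
  ... | no  T≢0 with C₂≡true⇒T≡tm i j (T≢0⇒C₂≡true i j T≢0) | neg1^-±1 (b (count j i))
  ...   | T≡tm | inj₁ tm≡1  = inj₂ (inj₂ (trans T≡tm tm≡1))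
  ...   | T≡tm | inj₂ tm≡-1 = inj₁ (trans T≡tm tm≡-1)
  zeros : ∀ i j → T i j ≡ + 0 ⇔ S i j ≡ + 0
  zeros i j = ⇔-trans (mk⇔ (T≡0⇒C₂≡false i j) (C₂≡false⇒T≡0 i j)) (⇔-sym (S≡0⇔C₂≡false i j))
  signs : ∀ i j → T i j ≢ + 0 → T i j ≡ tm (nonzerosAbove T j i)
  signs i j T≢0 = trans (C₂≡true⇒T≡tm i j (T≢0⇒C₂≡true i j T≢0)) (cong tm (sym (nonzerosAbove-T j i)))
  exhaustive : ∀ j n → ∃ λ i → T i j ≢ + 0 × nonzerosAbove T j i ≡ n
  exhaustive j n = let (i , e , k) = count-surjective j n in
    i , C₂≡true⇒T≢0 i j e , trans (nonzerosAbove-T j i) k
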